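{- Let $2^p-1$ and $2^q-1$ be Mersenne primes with $p<q$. If $k$ is an integer with $k\geq (p-1)(q-1)$, then \[B(k)\geq 2^k(1-2^{ -q})^{\frac{k-p(q-1)}{q}}(1-2^{ -p})^{q-1}.\]
   Context: Let $\overline{\psi}$ be the multiplicative arithmetic function with $\overline{\psi}(p^{\alpha})=p^{\alpha-1}(p+1)$ for odd primes $p$ and $\overline{\psi}(2^{\alpha})=2^{\alpha-1}$, for all positive integers $\alpha$ (so $\overline{\psi}(1)=1$). For $n>1$, $\lambda(n)$ is the unique nonnegative integer with $\overline{\psi}^{\lambda(n)}(n)=2$ (where $\overline{\psi}^k$ is the $k$-th iterate, $\overline{\psi}^0(n)=n$), and $\lambda(1)=0$. For each nonnegative integer $k\neq 1$, $B(k)$ denotes the largest odd positive integer $n$ with $\lambda(n)=k$ (such a number exists). -}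

module Defs where

open import Data.Nat using (ℕ; zero; suc; _+_; _*_; _∸_; _^_; _≤_; _<_)
open import Data.Nat.Divisibility using (_∣_)
open import Data.Nat.Coprimality using (Coprime)
open import Data.Nat.Primality using (Prime)
open import Data.Product using (_×_)
open import Data.Sum using (_⊎_)
open import Relation.Binary.PropositionalEquality using (_≡_)
open import Relation.Nullary using (¬_)

Odd : ℕ → Set
Odd n = ¬ (2 ∣ n)

iter : (ℕ → ℕ) → ℕ → ℕ → ℕ
iter f zero    n = n
iter f (suc k) n = f (iter f k n)

-- ψ is the multiplicative arithmetic function \overline{ψ} of the paper
-- (specified on positive integers: ψ(1)=1, multiplicative, and its values on prime powers).
IsPsiBar : (ℕ → ℕ) → Set
IsPsiBar ψ =
  (ψ 1 ≡ 1)
  × (∀ m n → 0 < m → 0 < n → Coprime m n → ψ (m * n) ≡ ψ m * ψ n)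
  × (∀ p α → Prime p → Odd p → 1 ≤ α → ψ (p ^ α) ≡ p ^ (α ∸ 1) * (p + 1))
  × (∀ α → 1 ≤ α → ψ (2 ^ α) ≡ 2 ^ (α ∸ 1))

-- Lam ψ n k  :⟺  λ(n) = k   (for positive n)
Lam : (ℕ → ℕ) → ℕ → ℕ → Set
Lam ψ n k = (n ≡ 1 × k ≡ 0) ⊎ (1 < n × iter ψ k n ≡ 2)

-- IsB ψ k b  :⟺  b = B(k), the largest odd positive n with λ(n) = k
IsB : (ℕ → ℕ) → ℕ → ℕ → Set
IsB ψ k b = Odd b × Lam ψ b k × (∀ n → Odd n → Lam ψ n k → n ≤ b)

{-# OPTIONS --safe #-}
-- The exponents p and q are coprime (a common divisor d makes 2^d - 1 a common divisor of the
-- two Mersenne primes), so since k ≥ (p - 1)(q - 1) one can write k = a q + c p with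
-- 0 ≤ c ≤ q - 1. Put A = 2^q - 1 and P = 2^p - 1. The map ψ̄ sends A^a P^c 2^e to
-- A^(a-1) P^(c-1) 2^(q+p+e-1), so every factor A costs q iterations and every factor P
-- costs p, giving λ(A^a P^c) = k and hence B(k)^q ≥ A^(aq) P^(cq). The claim then reduces to
-- P^(q(q-1-c)) ≤ A^(p(q-1-c)), a consequence of (2^p - 1)^q ≤ (2^q - 1)^p.
module Submission where

open import Defs
open import Data.Nat using (ℕ; zero; suc; z≤n; s≤s; _+_; _*_; _∸_; _^_; _≤_; _<_; NonZero; >-nonZero)
open import Data.Nat.Properties
open import Data.Nat.Divisibility
open import Data.Nat.DivMod using (_/_; _%_; m≡m%n+[m/n]*n; m%n<n)
open import Data.Nat.Coprimality using (Coprime; prime⇒coprime; coprime-divisor; coprime-Bézout)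
import Data.Nat.Coprimality as Coprimality
open import Data.Nat.GCD using (module Bézout)
open import Data.Nat.Primality using (Prime; prime[2]; euclidsLemma; prime⇒irreducible)
open import Data.Product using (_×_; _,_; proj₁; proj₂; ∃₂)
open import Data.Sum using (_⊎_; inj₁; inj₂)
open import Data.Empty using (⊥; ⊥-elim)
open import Relation.Binary.PropositionalEquality
open import Data.Nat.Tactic.RingSolver using (solve-∀)

m*n>0 : ∀ {m n} → 0 < m → 0 < n → 0 < m * n
m*n>0 {suc m} {suc n} _ _ = s≤s z≤n

^-distribʳ-* : ∀ m n o → (m * n) ^ o ≡ m ^ o * n ^ o
^-distribʳ-* m n zero = refl
^-distribʳ-* m n (suc o) = trans (cong (m * n *_) (^-distribʳ-* m n o)) (shuffle m n (m ^ o) (n ^ o))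
  where
  shuffle : ∀ a b c d → a * b * (c * d) ≡ a * c * (b * d)
  shuffle = solve-∀

merge-2^ : ∀ u v s t e → u * 2 ^ s * (v * 2 ^ t) * 2 ^ e ≡ u * v * 2 ^ (s + (t + e))
merge-2^ u v s t e = begin
  u * 2 ^ s * (v * 2 ^ t) * 2 ^ e    ≡⟨ regroup u v (2 ^ s) (2 ^ t) (2 ^ e) ⟩
  u * v * (2 ^ s * (2 ^ t * 2 ^ e))  ≡⟨ cong (λ x → u * v * (2 ^ s * x)) (sym (^-distribˡ-+-* 2 t e)) ⟩
  u * v * (2 ^ s * 2 ^ (t + e))      ≡⟨ cong (u * v *_) (sym (^-distribˡ-+-* 2 s (t + e))) ⟩
  u * v * 2 ^ (s + (t + e))          ∎
  where
  open ≡-Reasoning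
  regroup : ∀ u v x y z → u * x * (v * y) * z ≡ u * v * (x * (y * z))
  regroup = solve-∀

odd-* : ∀ {m n} → Odd m → Odd n → Odd (m * n)
odd-* {m} {n} odd-m odd-n 2∣mn with euclidsLemma m n prime[2] 2∣mn
... | inj₁ 2∣m = odd-m 2∣m
... | inj₂ 2∣n = odd-n 2∣n

odd-^ : ∀ {m} n → Odd m → Odd (m ^ n)
odd-^ zero    _     2∣1 with ∣1⇒≡1 2∣1
... | ()
odd-^ (suc n) odd-m = odd-* odd-m (odd-^ n odd-m)

coprime-*ʳ : ∀ {m n o} → Coprime m n → Coprime m o → Coprime m (n * o)
coprime-*ʳ {n = n} m⊥n m⊥o {d} (d∣m , d∣no) = m⊥o (d∣m , coprime-divisor d⊥n d∣no)
  where
  d⊥n : Coprime d n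
  d⊥n (e∣d , e∣n) = m⊥n (∣-trans e∣d d∣m , e∣n)

coprime-^ʳ : ∀ {m n} o → Coprime m n → Coprime m (n ^ o)
coprime-^ʳ zero    _   (_ , d∣1) = ∣1⇒≡1 d∣1
coprime-^ʳ (suc o) m⊥n = coprime-*ʳ m⊥n (coprime-^ʳ o m⊥n)

m∣[1+m]^n∸1 : ∀ m n → m ∣ suc m ^ n ∸ 1
m∣[1+m]^n∸1 m zero    = m ∣0
m∣[1+m]^n∸1 m (suc n) = subst (m ∣_) (sym (split (suc m ^ n) (m^n>0 (suc m) n)))
  (∣m∣n⇒∣m+n (m∣m*n (suc m ^ n)) (m∣[1+m]^n∸1 m n))
  where
  split : ∀ x → 0 < x → suc m * x ∸ 1 ≡ m * x + (x ∸ 1)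
  split (suc x) _ = +-comm x (m * suc x)

prime∧2<⇒odd : ∀ {m} → Prime m → 2 < m → Odd m
prime∧2<⇒odd m-prime 2<m 2∣m with prime⇒irreducible m-prime 2∣m
... | inj₁ ()
... | inj₂ refl = <-irrefl refl 2<m

2^n∸1+1≡2^n : ∀ n → 2 ^ n ∸ 1 + 1 ≡ 2 ^ n
2^n∸1+1≡2^n n = m∸n+n≡m (m^n>0 2 n)

2<2^[2+n]∸1 : ∀ n → 2 < 2 ^ suc (suc n) ∸ 1
2<2^[2+n]∸1 n = ∸-monoˡ-≤ 1 (^-monoʳ-≤ 2 {2} {suc (suc n)} (s≤s (s≤s z≤n)))

2^n∸1≡1⇒n≡1 : ∀ {n} → 2 ^ n ∸ 1 ≡ 1 → n ≡ 1
2^n∸1≡1⇒n≡1 {suc zero}    _  = refl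
2^n∸1≡1⇒n≡1 {suc (suc n)} eq = ⊥-elim (<-irrefl (sym eq) (<-trans (s≤s (s≤s z≤n)) (2<2^[2+n]∸1 n)))

2^d∸1∣2^n∸1 : ∀ {d n} → d ∣ n → 2 ^ d ∸ 1 ∣ 2 ^ n ∸ 1
2^d∸1∣2^n∸1 {d} (divides t refl) = subst (λ x → 2 ^ d ∸ 1 ∣ x ∸ 1) 2^d^t≡2^[td]
  (m∣[1+m]^n∸1 (2 ^ d ∸ 1) t)
  where
  2^d^t≡2^[td] : suc (2 ^ d ∸ 1) ^ t ≡ 2 ^ (t * d)
  2^d^t≡2^[td] = begin
    suc (2 ^ d ∸ 1) ^ t ≡⟨ cong (_^ t) (trans (+-comm 1 (2 ^ d ∸ 1)) (2^n∸1+1≡2^n d)) ⟩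
    (2 ^ d) ^ t         ≡⟨ ^-*-assoc 2 d t ⟩
    2 ^ (d * t)         ≡⟨ cong (2 ^_) (*-comm d t) ⟩
    2 ^ (t * d)         ∎
    where open ≡-Reasoning

mersenne-prime⇒2< : ∀ n → Prime (2 ^ n ∸ 1) → 2 < 2 ^ n ∸ 1
mersenne-prime⇒2< (suc (suc n)) _ = 2<2^[2+n]∸1 n

mersenne-prime⇒1< : ∀ n → Prime (2 ^ n ∸ 1) → 1 < n
mersenne-prime⇒1< (suc (suc n)) _ = s≤s (s≤s z≤n)

mersenne-<-mono : ∀ {m n} → m < n → 2 ^ m ∸ 1 < 2 ^ n ∸ 1
mersenne-<-mono {m} m<n = ∸-monoˡ-< (^-monoʳ-< 2 (s≤s (s≤s z≤n)) m<n) (m^n>0 2 m)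

mersenne-exponents-coprime : ∀ {p q} → Prime (2 ^ p ∸ 1) → Prime (2 ^ q ∸ 1) → p < q → Coprime p q
mersenne-exponents-coprime {p} {q} P-prime A-prime p<q {d} (d∣p , d∣q)
  with prime⇒irreducible P-prime (2^d∸1∣2^n∸1 d∣p)
... | inj₁ 2^d∸1≡1 = 2^n∸1≡1⇒n≡1 2^d∸1≡1
... | inj₂ D≡P with prime⇒irreducible A-prime (subst (_∣ 2 ^ q ∸ 1) D≡P (2^d∸1∣2^n∸1 d∣q))
...   | inj₁ P≡1 = ⊥-elim (<-irrefl (sym P≡1) (<-trans (s≤s (s≤s z≤n)) (mersenne-prime⇒2< p P-prime)))
...   | inj₂ P≡A = ⊥-elim (<-irrefl P≡A (mersenne-<-mono p<q))

coprime⇒inverse : ∀ {p q} → Coprime p q → 1 < q → ∃₂ λ x y → x * p ≡ 1 + y * q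
coprime⇒inverse {p} {suc (suc q₂)} p⊥q (s≤s (s≤s z≤n)) with coprime-Bézout p⊥q
... | Bézout.+- x y eq       = x , y , sym eq
... | Bézout.-+ x (suc y) eq = suc q₂ * x , y + q₂ * suc y , +-cancelˡ-≡ (suc q₂) _ _ (begin
  suc q₂ + suc q₂ * x * p  ≡⟨ distrib q₂ x p ⟩
  suc q₂ * (1 + x * p)     ≡⟨ cong (suc q₂ *_) eq ⟩
  suc q₂ * (suc y * q)     ≡⟨ expand q₂ y ⟩
  suc q₂ + (1 + (y + q₂ * suc y) * q) ∎)
  where
  open ≡-Reasoning
  q = suc (suc q₂)
  distrib : ∀ m u v → suc m + suc m * u * v ≡ suc m * (1 + u * v)
  distrib = solve-∀
  expand : ∀ m n → suc m * (suc n * suc (suc m)) ≡ suc m + (1 + (n + m * suc n) * suc (suc m))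
  expand = solve-∀

n*m≤[m∸1]*n+n : ∀ m n → n * m ≤ (m ∸ 1) * n + n
n*m≤[m∸1]*n+n zero    n = subst (_≤ n) (sym (*-zeroʳ n)) z≤n
n*m≤[m∸1]*n+n (suc m) n = ≤-reflexive (expand m n)
  where
  expand : ∀ m n → n * suc m ≡ m * n + n
  expand = solve-∀

-- As x p ≡ 1 (mod q), writing x k = c + s q with 0 ≤ c < q gives c p ≡ k (mod q); the representation
-- exists unless c p ≥ k + q, which the bound on k rules out.
representation-from-inverse : ∀ {p q₁ x y} → x * p ≡ 1 + y * suc q₁ →
  ∀ k → (p ∸ 1) * q₁ ≤ k → ∃₂ λ a c → c < suc q₁ × a * suc q₁ + c * p ≡ k
representation-from-inverse {p} {q₁} {x} {y} xp≡1+yq k k≥ = split (≤-<-connex (k * y) (s * p))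
  where
  q t c s : ℕ
  q = suc q₁
  t = x * k
  c = t % q
  s = t / q

  key : c * p + s * p * q ≡ k + k * y * q
  key = begin
    c * p + s * p * q  ≡⟨ factor c s p q ⟩
    (c + s * q) * p    ≡⟨ cong (_* p) (sym (m≡m%n+[m/n]*n t q)) ⟩
    x * k * p          ≡⟨ regroup x k p ⟩
    k * (x * p)        ≡⟨ cong (k *_) xp≡1+yq ⟩
    k * (1 + y * q)    ≡⟨ expand k y q ⟩
    k + k * y * q      ∎
    where
    open ≡-Reasoning
    factor : ∀ c s p q → c * p + s * p * q ≡ (c + s * q) * p
    factor = solve-∀
    regroup : ∀ x k p → x * k * p ≡ k * (x * p)
    regroup = solve-∀
    expand : ∀ k y q → k * (1 + y * q) ≡ k + k * y * q
    expand = solve-∀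

  split : k * y ≤ s * p ⊎ s * p < k * y → ∃₂ λ a c → c < q × a * q + c * p ≡ k
  split (inj₁ ky≤sp) = a , c , m%n<n t q , +-cancelʳ-≡ (k * y * q) _ _ (begin
    a * q + c * p + k * y * q  ≡⟨ regroup a (c * p) (k * y) q ⟩
    c * p + (k * y + a) * q    ≡⟨ cong (λ z → c * p + z * q) (m+[n∸m]≡n ky≤sp) ⟩
    c * p + s * p * q          ≡⟨ key ⟩
    k + k * y * q              ∎)
    where
    open ≡-Reasoning
    a = s * p ∸ k * y
    regroup : ∀ a b u q → a * q + b + u * q ≡ b + (u + a) * q
    regroup = solve-∀
  split (inj₂ sp<ky) = ⊥-elim (<⇒≱ cp<k+q k+q≤cp)
    where
    k+q≤cp : k + q ≤ c * p
    k+q≤cp = +-cancelʳ-≤ (s * p * q) _ _ (begin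
      k + q + s * p * q    ≡⟨ +-assoc k q (s * p * q) ⟩
      k + suc (s * p) * q  ≤⟨ +-monoʳ-≤ k (*-monoˡ-≤ q sp<ky) ⟩
      k + k * y * q        ≡⟨ sym key ⟩
      c * p + s * p * q    ∎)
      where open ≤-Reasoning
    cp<k+q : c * p < k + q
    cp<k+q = begin-strict
      c * p              ≤⟨ *-monoˡ-≤ p (≤-pred (m%n<n t q)) ⟩
      q₁ * p             ≤⟨ n*m≤[m∸1]*n+n p q₁ ⟩
      (p ∸ 1) * q₁ + q₁  <⟨ +-monoʳ-< ((p ∸ 1) * q₁) (n<1+n q₁) ⟩
      (p ∸ 1) * q₁ + q   ≤⟨ +-monoˡ-≤ q k≥ ⟩
      k + q              ∎
      where open ≤-Reasoning

frobenius-representation : ∀ {p q} → Coprime p q → 1 < q →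
  ∀ k → (p ∸ 1) * (q ∸ 1) ≤ k → ∃₂ λ a c → c < q × a * q + c * p ≡ k
frobenius-representation {q = suc q₁} p⊥q 1<q k k≥ with coprime⇒inverse p⊥q 1<q
... | x , y , xp≡1+yq = representation-from-inverse {x = x} {y} xp≡1+yq k k≥

[2^p∸1]^q≤[2^q∸1]^p : ∀ {p q} → p ≤ q → (2 ^ p ∸ 1) ^ q ≤ (2 ^ q ∸ 1) ^ p
[2^p∸1]^q≤[2^q∸1]^p {p} p≤q with m≤n⇒∃[o]m+o≡n p≤q
... | d , refl = *-cancelʳ-≤ _ _ (X ^ p) {{>-nonZero X^p>0}} (begin
  (X ∸ 1) ^ (p + d) * X ^ p        ≡⟨ cong (_* X ^ p) (^-distribˡ-+-* (X ∸ 1) p d) ⟩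
  (X ∸ 1) ^ p * (X ∸ 1) ^ d * X ^ p ≤⟨ *-monoˡ-≤ (X ^ p) (*-monoʳ-≤ ((X ∸ 1) ^ p) (^-monoˡ-≤ d (m∸n≤m X 1))) ⟩
  (X ∸ 1) ^ p * X ^ d * X ^ p      ≡⟨ regroup ((X ∸ 1) ^ p) (X ^ d) (X ^ p) ⟩
  (X ∸ 1) ^ p * (X ^ p * X ^ d)    ≡⟨ cong ((X ∸ 1) ^ p *_) (sym Y^p≡X^p*X^d) ⟩
  (X ∸ 1) ^ p * Y ^ p              ≡⟨ sym (^-distribʳ-* (X ∸ 1) Y p) ⟩
  ((X ∸ 1) * Y) ^ p                ≤⟨ ^-monoˡ-≤ p [X∸1]Y≤[Y∸1]X ⟩
  ((Y ∸ 1) * X) ^ p                ≡⟨ ^-distribʳ-* (Y ∸ 1) X p ⟩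
  (Y ∸ 1) ^ p * X ^ p              ∎)
  where
  open ≤-Reasoning
  X Y : ℕ
  X = 2 ^ p
  Y = 2 ^ (p + d)

  X^p>0 : 0 < X ^ p
  X^p>0 = m^n>0 X {{>-nonZero (m^n>0 2 p)}} p

  regroup : ∀ a b c → a * b * c ≡ a * (c * b)
  regroup = solve-∀

  [X∸1]Y≤[Y∸1]X : (X ∸ 1) * Y ≤ (Y ∸ 1) * X
  [X∸1]Y≤[Y∸1]X = begin
    (X ∸ 1) * Y    ≡⟨ *-distribʳ-∸ Y X 1 ⟩
    X * Y ∸ 1 * Y  ≡⟨ cong₂ _∸_ (*-comm X Y) (*-identityˡ Y) ⟩
    Y * X ∸ Y      ≤⟨ ∸-monoʳ-≤ (Y * X) (^-monoʳ-≤ 2 (m≤m+n p d)) ⟩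
    Y * X ∸ X      ≡⟨ cong (Y * X ∸_) (sym (*-identityˡ X)) ⟩
    Y * X ∸ 1 * X  ≡⟨ sym (*-distribʳ-∸ X Y 1) ⟩
    (Y ∸ 1) * X    ∎

  Y^p≡X^p*X^d : Y ^ p ≡ X ^ p * X ^ d
  Y^p≡X^p*X^d = begin-equality
    Y ^ p            ≡⟨ ^-*-assoc 2 (p + d) p ⟩
    2 ^ ((p + d) * p) ≡⟨ cong (2 ^_) (*-comm (p + d) p) ⟩
    2 ^ (p * (p + d)) ≡⟨ sym (^-*-assoc 2 p (p + d)) ⟩
    X ^ (p + d)      ≡⟨ ^-distribˡ-+-* X p d ⟩
    X ^ p * X ^ d    ∎

^-exchange-≤ : ∀ {A P p q} a c r → P ^ q ≤ A ^ p →
  A ^ (a * q + c * p) * P ^ (q * (c + r)) ≤ (A ^ a * P ^ c) ^ q * A ^ (p * (c + r))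
^-exchange-≤ {A} {P} {p} {q} a c r P^q≤A^p = begin
  A ^ (a * q + c * p) * P ^ (q * (c + r))
    ≡⟨ cong₂ _*_ (^-distribˡ-+-* A (a * q) (c * p)) (^-+-split P q c r) ⟩
  A ^ (a * q) * A ^ (c * p) * (P ^ (q * c) * P ^ (q * r))
    ≡⟨ sym (*-assoc (A ^ (a * q) * A ^ (c * p)) (P ^ (q * c)) (P ^ (q * r))) ⟩
  M * P ^ (q * r)
    ≤⟨ *-monoʳ-≤ M (subst₂ _≤_ (^-*-assoc P q r) (^-*-assoc A p r) (^-monoˡ-≤ r P^q≤A^p)) ⟩
  M * A ^ (p * r)
    ≡⟨ shuffle (A ^ (a * q)) (A ^ (c * p)) (P ^ (q * c)) (A ^ (p * r)) ⟩
  A ^ (a * q) * P ^ (q * c) * (A ^ (c * p) * A ^ (p * r))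
    ≡⟨ cong₂ _*_ (sym (cong₂ _*_ (^-*-assoc A a q) (trans (^-*-assoc P c q) (cong (P ^_) (*-comm c q)))))
                 (sym (trans (^-+-split A p c r) (cong (λ e → A ^ e * A ^ (p * r)) (*-comm p c)))) ⟩
  (A ^ a) ^ q * (P ^ c) ^ q * A ^ (p * (c + r))
    ≡⟨ cong (_* A ^ (p * (c + r))) (sym (^-distribʳ-* (A ^ a) (P ^ c) q)) ⟩
  (A ^ a * P ^ c) ^ q * A ^ (p * (c + r)) ∎
  where
  open ≤-Reasoning
  M : ℕ
  M = A ^ (a * q) * A ^ (c * p) * P ^ (q * c)
  ^-+-split : ∀ m n o o′ → m ^ (n * (o + o′)) ≡ m ^ (n * o) * m ^ (n * o′)
  ^-+-split m n o o′ = trans (cong (m ^_) (*-distribˡ-+ n o o′)) (^-distribˡ-+-* m (n * o) (n * o′))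
  shuffle : ∀ u v w z → u * v * w * z ≡ u * w * (v * z)
  shuffle = solve-∀

1≤m+suc[n] : ∀ m n → 1 ≤ m + suc n
1≤m+suc[n] m n = ≤-trans (s≤s z≤n) (m≤n+m (suc n) m)

iter-suc : ∀ f k n → iter f (suc k) n ≡ iter f k (f n)
iter-suc f zero    n = refl
iter-suc f (suc k) n = cong f (iter-suc f k n)

mersenne-prime⇒odd : ∀ n → Prime (2 ^ n ∸ 1) → Odd (2 ^ n ∸ 1)
mersenne-prime⇒odd n M-prime = prime∧2<⇒odd M-prime (mersenne-prime⇒2< n M-prime)

module PsiBar (ψ : ℕ → ℕ) (isψ : IsPsiBar ψ) where

  ψ-1 : ψ 1 ≡ 1
  ψ-1 = proj₁ isψ

  ψ-* : ∀ m n → 0 < m → 0 < n → Coprime m n → ψ (m * n) ≡ ψ m * ψ n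
  ψ-* = proj₁ (proj₂ isψ)

  ψ-2^ : ∀ e → ψ (2 ^ e) ≡ 2 ^ (e ∸ 1)
  ψ-2^ zero    = ψ-1
  ψ-2^ (suc e) = proj₂ (proj₂ (proj₂ isψ)) (suc e) (s≤s z≤n)

  ψ-mersenne^ : ∀ r → Prime (2 ^ r ∸ 1) → ∀ a → ψ ((2 ^ r ∸ 1) ^ suc a) ≡ (2 ^ r ∸ 1) ^ a * 2 ^ r
  ψ-mersenne^ r M-prime a =
    trans (proj₁ (proj₂ (proj₂ isψ)) _ (suc a) M-prime (mersenne-prime⇒odd r M-prime) (s≤s z≤n))
          (cong ((2 ^ r ∸ 1) ^ a *_) (2^n∸1+1≡2^n r))

  iter-ψ-1 : ∀ k → iter ψ k 1 ≡ 1
  iter-ψ-1 zero    = refl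
  iter-ψ-1 (suc k) = trans (cong ψ (iter-ψ-1 k)) ψ-1

  iter-ψ≡2⇒1< : ∀ {k n} → 0 < n → iter ψ k n ≡ 2 → 1 < n
  iter-ψ≡2⇒1< {k} n>0 iter≡2 = ≤∧≢⇒< n>0 λ { refl → 1≢2 (trans (sym (iter-ψ-1 k)) iter≡2) }
    where
    1≢2 : 1 ≡ 2 → ⊥
    1≢2 ()

  iter-ψ-step : ∀ {M N n n′} → ψ n ≡ n′ → suc M ≡ N → iter ψ M n′ ≡ 2 → iter ψ N n ≡ 2
  iter-ψ-step {M} {n = n} ψn≡n′ refl iter≡2 =
    trans (iter-suc ψ M n) (trans (cong (iter ψ M) ψn≡n′) iter≡2)

  module Orbit {p₁ q₁ : ℕ} (P-prime : Prime (2 ^ suc p₁ ∸ 1)) (A-prime : Prime (2 ^ suc q₁ ∸ 1))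
               (p<q : suc p₁ < suc q₁) where

    p q A P : ℕ
    p = suc p₁
    q = suc q₁
    A = 2 ^ q ∸ 1
    P = 2 ^ p ∸ 1

    2<A : 2 < A
    2<A = mersenne-prime⇒2< q A-prime

    2<P : 2 < P
    2<P = mersenne-prime⇒2< p P-prime

    instance
      A≢0 : NonZero A
      A≢0 = >-nonZero (<-trans (s≤s z≤n) 2<A)
      P≢0 : NonZero P
      P≢0 = >-nonZero (<-trans (s≤s z≤n) 2<P)

    2⊥A : Coprime 2 A
    2⊥A = Coprimality.sym (prime⇒coprime A-prime 2<A)

    2⊥P : Coprime 2 P
    2⊥P = Coprimality.sym (prime⇒coprime P-prime 2<P)

    P⊥A : Coprime P A
    P⊥A = Coprimality.sym (prime⇒coprime A-prime (mersenne-<-mono p<q))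

    ψ-split : ∀ a c e → ψ (A ^ a * P ^ c * 2 ^ e) ≡ ψ (A ^ a) * ψ (P ^ c) * 2 ^ (e ∸ 1)
    ψ-split a c e =
      trans (ψ-* (A ^ a * P ^ c) (2 ^ e) (m*n>0 (m^n>0 A a) (m^n>0 P c)) (m^n>0 2 e) A^aP^c⊥2^e)
            (cong₂ _*_ (ψ-* (A ^ a) (P ^ c) (m^n>0 A a) (m^n>0 P c) A^a⊥P^c) (ψ-2^ e))
      where
      A^aP^c⊥2^e : Coprime (A ^ a * P ^ c) (2 ^ e)
      A^aP^c⊥2^e = coprime-^ʳ e (Coprimality.sym (coprime-*ʳ (coprime-^ʳ a 2⊥A) (coprime-^ʳ c 2⊥P)))
      A^a⊥P^c : Coprime (A ^ a) (P ^ c)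
      A^a⊥P^c = coprime-^ʳ c (Coprimality.sym (coprime-^ʳ a P⊥A))

    -- ψ 1 ≡ 1 enters as 1 * 2 ^ 0 (definitionally), so all three shapes are instances of merge-2^.
    ψ-step-AP : ∀ a c e → ψ (A ^ suc a * P ^ suc c * 2 ^ e) ≡ A ^ a * P ^ c * 2 ^ (q + (p + (e ∸ 1)))
    ψ-step-AP a c e = trans (ψ-split (suc a) (suc c) e)
      (trans (cong₂ (λ x y → x * y * 2 ^ (e ∸ 1)) (ψ-mersenne^ q A-prime a) (ψ-mersenne^ p P-prime c))
             (merge-2^ (A ^ a) (P ^ c) q p (e ∸ 1)))

    ψ-step-A : ∀ a e → ψ (A ^ suc a * 1 * 2 ^ e) ≡ A ^ a * 1 * 2 ^ (q + (e ∸ 1))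
    ψ-step-A a e = trans (ψ-split (suc a) 0 e)
      (trans (cong₂ (λ x y → x * y * 2 ^ (e ∸ 1)) (ψ-mersenne^ q A-prime a) ψ-1)
             (merge-2^ (A ^ a) 1 q 0 (e ∸ 1)))

    ψ-step-P : ∀ c e → ψ (1 * P ^ suc c * 2 ^ e) ≡ 1 * P ^ c * 2 ^ (p + (e ∸ 1))
    ψ-step-P c e = trans (ψ-split 0 (suc c) e)
      (trans (cong₂ (λ x y → x * y * 2 ^ (e ∸ 1)) ψ-1 (ψ-mersenne^ p P-prime c))
             (merge-2^ 1 (P ^ c) 0 p (e ∸ 1)))

    orbit : ∀ a c e → 1 ≤ a + c + e → iter ψ (a * q + c * p + (e ∸ 1)) (A ^ a * P ^ c * 2 ^ e) ≡ 2
    orbit zero    zero    (suc zero)      _ = refl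
    orbit zero    zero    (suc (suc e))   _ = iter-ψ-step {e}
      (trans (ψ-split 0 0 (suc (suc e))) (cong (λ x → x * x * 2 ^ suc e) ψ-1)) refl
      (orbit 0 0 (suc e) (s≤s z≤n))
    orbit (suc a) (suc c) e _ = iter-ψ-step (ψ-step-AP a c e) (sym (count a c q₁ p₁ (e ∸ 1)))
      (orbit a c (q + (p + (e ∸ 1))) (1≤m+suc[n] (a + c) _))
      where
      count : ∀ a c q₁ p₁ r → suc a * suc q₁ + suc c * suc p₁ + r
                               ≡ suc (a * suc q₁ + c * suc p₁ + (q₁ + (suc p₁ + r)))
      count = solve-∀
    orbit (suc a) zero    e _ = iter-ψ-step (ψ-step-A a e) (sym (count a q₁ p (e ∸ 1)))
      (orbit a 0 (q + (e ∸ 1)) (1≤m+suc[n] (a + 0) _))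
      where
      count : ∀ a q₁ p r → suc a * suc q₁ + 0 * p + r ≡ suc (a * suc q₁ + 0 * p + (q₁ + r))
      count = solve-∀
    orbit zero    (suc c) e _ = iter-ψ-step (ψ-step-P c e) (sym (count c q p₁ (e ∸ 1)))
      (orbit 0 c (p + (e ∸ 1)) (1≤m+suc[n] (0 + c) _))
      where
      count : ∀ c q p₁ r → 0 * q + suc c * suc p₁ + r ≡ suc (0 * q + c * suc p₁ + (p₁ + r))
      count = solve-∀

    odd-witness : ∀ a c → 0 < a * q + c * p →
                  Odd (A ^ a * P ^ c) × Lam ψ (A ^ a * P ^ c) (a * q + c * p)
    odd-witness a c k>0 =
        odd-* (odd-^ a (mersenne-prime⇒odd q A-prime)) (odd-^ c (mersenne-prime⇒odd p P-prime))
      , inj₂ (iter-ψ≡2⇒1< {a * q + c * p} (m*n>0 (m^n>0 A a) (m^n>0 P c)) iter≡2 , iter≡2)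
      where
      iter≡2 : iter ψ (a * q + c * p) (A ^ a * P ^ c) ≡ 2
      iter≡2 = subst₂ (λ k n → iter ψ k n ≡ 2) (+-identityʳ (a * q + c * p)) (*-identityʳ (A ^ a * P ^ c))
        (orbit a c 0 (1≤a+c+0 a c k>0))
        where
        1≤a+c+0 : ∀ a c → 0 < a * q + c * p → 1 ≤ a + c + 0
        1≤a+c+0 (suc a) c       _ = s≤s z≤n
        1≤a+c+0 zero    (suc c) _ = s≤s z≤n

theorem2p4 : (ψ : ℕ → ℕ) → IsPsiBar ψ →
    (p q : ℕ) → Prime (2 ^ p ∸ 1) → Prime (2 ^ q ∸ 1) → p < q →
    (k : ℕ) → (p ∸ 1) * (q ∸ 1) ≤ k →
    (b : ℕ) → IsB ψ k b →
    (2 ^ q ∸ 1) ^ k * (2 ^ p ∸ 1) ^ (q * (q ∸ 1)) ≤ b ^ q * (2 ^ q ∸ 1) ^ (p * (q ∸ 1))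
theorem2p4 ψ isψ (suc p₁) (suc q₁) P-prime A-prime p<q k k≥ b (_ , _ , b-max)
  with frobenius-representation (mersenne-exponents-coprime P-prime A-prime p<q)
         (mersenne-prime⇒1< (suc q₁) A-prime) k k≥
... | a , c , c<q , refl =
  subst (λ m → A ^ (a * q + c * p) * P ^ (q * m) ≤ b ^ q * A ^ (p * m)) (m+[n∸m]≡n (≤-pred c<q))
    (≤-trans (^-exchange-≤ a c (q₁ ∸ c) ([2^p∸1]^q≤[2^q∸1]^p (<⇒≤ p<q)))
             (*-monoˡ-≤ (A ^ (p * (c + (q₁ ∸ c)))) (^-monoˡ-≤ q A^aP^c≤b)))
  where
  open PsiBar ψ isψ
  open Orbit P-prime A-prime p<q
  k>0 : 0 < a * q + c * p
  k>0 = <-≤-trans (m*n>0 (≤-pred (mersenne-prime⇒1< p P-prime)) (≤-pred (mersenne-prime⇒1< q A-prime))) k≥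
  A^aP^c≤b : A ^ a * P ^ c ≤ b
  A^aP^c≤b = let odd , λ≡k = odd-witness a c k>0 in b-max _ odd λ≡k
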